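{- Let $V$ be a finite non-empty set and $T:\mathscr{P}(V)\to\mathscr{P}(V)$ a map. If $(E_1,E_2)$ is the unique pair of equivalence relations on $V$ with $T(X)=\mathbf{l}_{E_2}(\mathbf{l}_{E_1}(X))$ for all $X\subseteq V$, and $E_1\neq Id$ or $E_2\neq Id$ (where $Id$ is the identity relation on $V$), then $E_1\not\subseteq E_2$ and $E_2\not\subseteq E_1$.
   Context: For an equivalence relation $E$ on $V$: $\mathbf{l}_E(X)=\{x\in V:[x]_E\subseteq X\}$. Equivalence relations are compared as sets of pairs. -}

module Defs where

open import Data.Nat using (ℕ)
open import Data.Bool using (Bool; true; false; not; _∨_)
open import Data.Fin using (Fin; _≟_)
open import Data.Fin.Subset using (Subset)
open import Data.Vec using (tabulate; lookup)
open import Data.List using (List; []; _∷_; allFin)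
open import Data.Bool using (_∧_)
open import Relation.Nullary.Decidable using (⌊_⌋)
open import Relation.Binary.PropositionalEquality using (_≡_)
open import Relation.Nullary using (¬_)
open import Data.Product using (_×_)

-- The finite set V is Fin n; subsets of V are Data.Fin.Subset (Vec Bool n).
-- A (binary) relation on V is a Boolean-valued function, i.e. a set of pairs.
Rel₂ : ℕ → Set
Rel₂ n = Fin n → Fin n → Bool

record IsEqRel {n : ℕ} (E : Rel₂ n) : Set where
  field
    reflE  : ∀ x → E x x ≡ true
    symE   : ∀ x y → E x y ≡ true → E y x ≡ true
    transE : ∀ x y z → E x y ≡ true → E y z ≡ true → E x z ≡ true

_≐_ : {n : ℕ} → Rel₂ n → Rel₂ n → Set
E ≐ F = ∀ x y → E x y ≡ F x y

_⊆ᵣ_ : {n : ℕ} → Rel₂ n → Rel₂ n → Set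
E ⊆ᵣ F = ∀ x y → E x y ≡ true → F x y ≡ true

Id : {n : ℕ} → Rel₂ n
Id x y = ⌊ x ≟ y ⌋

allB : {A : Set} → (A → Bool) → List A → Bool
allB p [] = true
allB p (a ∷ as) = p a ∧ allB p as

-- l_E(X) = { x ∈ V : [x]_E ⊆ X }
lower : {n : ℕ} → Rel₂ n → Subset n → Subset n
lower {n} E X = tabulate (λ x → allB (λ y → not (E x y) ∨ lookup X y) (allFin n))

module Submission where

-- If E₁ ⊆ E₂ then l_E₂ ∘ l_E₁ = l_E₂, and if E₂ ⊆ E₁ then l_E₂ ∘ l_E₁ = l_E₁; either way T is a
-- single lower approximation l_F. But l_F = l_F ∘ l_Id = l_Id ∘ l_F, so uniqueness of the
-- factorisation forces E₁ = Id and E₂ = Id.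

open import Defs
open import Data.Nat using (ℕ; suc)
open import Data.Bool using (Bool; true; false; not; _∨_)
open import Data.Bool.Properties using (∧-conicalˡ; ∧-conicalʳ; T-≡)
open import Data.Fin using (Fin; _≟_)
open import Data.Fin.Subset using (Subset; _∈_)
open import Data.Fin.Subset.Properties using (⊆-antisym)
open import Data.List using (List; []; _∷_; allFin)
open import Data.List.Membership.Propositional.Properties using (∈-allFin)
open import Data.List.Relation.Unary.Any using (here; there)
open import Data.Product using (_×_; _,_; proj₁; proj₂)
open import Data.Sum using (_⊎_; [_,_])
open import Data.Vec.Properties using (lookup∘tabulate; []=⇒lookup; lookup⇒[]=)
open import Function.Bundles using (Equivalence)
open import Relation.Nullary using (¬_)
open import Relation.Nullary.Decidable using (toWitness; fromWitness)
open import Relation.Binary.PropositionalEquality using (_≡_; refl; sym; trans; subst)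
import Data.List.Membership.Propositional as List

private
  variable
    n : ℕ

allB-true⁺ : {A : Set} (p : A → Bool) (xs : List A) → (∀ a → p a ≡ true) → allB p xs ≡ true
allB-true⁺ p []       pa≡true = refl
allB-true⁺ p (a ∷ as) pa≡true rewrite pa≡true a = allB-true⁺ p as pa≡true

allB-true⁻ : {A : Set} {p : A → Bool} {xs : List A} {a : A} →
             allB p xs ≡ true → a List.∈ xs → p a ≡ true
allB-true⁻ {p = p} {b ∷ _} all≡true (here refl) = ∧-conicalˡ (p b) _ all≡true
allB-true⁻ {p = p} {b ∷ _} all≡true (there a∈)  = allB-true⁻ (∧-conicalʳ (p b) _ all≡true) a∈

implication-true⁺ : (a b : Bool) → (a ≡ true → b ≡ true) → not a ∨ b ≡ true
implication-true⁺ false b a⇒b = refl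
implication-true⁺ true  b a⇒b = a⇒b refl

implication-true⁻ : (a b : Bool) → not a ∨ b ≡ true → a ≡ true → b ≡ true
implication-true⁻ true b b≡true refl = b≡true

∈-lower⁺ : (E : Rel₂ n) (X : Subset n) {x : Fin n} →
           (∀ y → E x y ≡ true → y ∈ X) → x ∈ lower E X
∈-lower⁺ {n} E X {x} class⊆X = lookup⇒[]= x _ (trans (lookup∘tabulate _ x)
  (allB-true⁺ _ (allFin n) λ y → implication-true⁺ (E x y) _ λ Exy → []=⇒lookup (class⊆X y Exy)))

∈-lower⁻ : (E : Rel₂ n) (X : Subset n) {x y : Fin n} →
           x ∈ lower E X → E x y ≡ true → y ∈ X
∈-lower⁻ E X {x} {y} x∈lower Exy = lookup⇒[]= y X (implication-true⁻ (E x y) _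
  (allB-true⁻ (trans (sym (lookup∘tabulate _ x)) ([]=⇒lookup x∈lower)) (∈-allFin y)) Exy)

module _ {E F : Rel₂ n}
         (E-refl : ∀ x → E x x ≡ true)
         (F-trans : ∀ x y z → F x y ≡ true → F y z ≡ true → F x z ≡ true)
         (E⊆F : E ⊆ᵣ F) where

  lower-absorbˡ : ∀ X → lower F (lower E X) ≡ lower F X
  lower-absorbˡ X = ⊆-antisym
    (λ x∈ → ∈-lower⁺ F X λ y Fxy → ∈-lower⁻ E X (∈-lower⁻ F (lower E X) x∈ Fxy) (E-refl y))
    (λ x∈ → ∈-lower⁺ F (lower E X) λ y Fxy → ∈-lower⁺ E X λ z Eyz →
      ∈-lower⁻ F X x∈ (F-trans _ y z Fxy (E⊆F y z Eyz)))

  lower-absorbʳ : ∀ X → lower E (lower F X) ≡ lower F X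
  lower-absorbʳ X = ⊆-antisym
    (λ x∈ → ∈-lower⁻ E (lower F X) x∈ (E-refl _))
    (λ x∈ → ∈-lower⁺ E (lower F X) λ y Exy → ∈-lower⁺ F X λ z Fyz →
      ∈-lower⁻ F X x∈ (F-trans _ y z (E⊆F _ y Exy) Fyz))

Id⇒≡ : {x y : Fin n} → Id x y ≡ true → x ≡ y
Id⇒≡ {x = x} {y} Idxy = toWitness {a? = x ≟ y} (Equivalence.from T-≡ Idxy)

Id-refl : (x : Fin n) → Id x x ≡ true
Id-refl x = Equivalence.to T-≡ (fromWitness {a? = x ≟ x} refl)

Id⊆ᵣ : {E : Rel₂ n} → (∀ x → E x x ≡ true) → Id ⊆ᵣ E
Id⊆ᵣ {E = E} E-refl x y Idxy = subst (λ z → E x z ≡ true) (Id⇒≡ Idxy) (E-refl x)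

Id-isEqRel : IsEqRel (Id {n})
Id-isEqRel = record
  { reflE  = Id-refl
  ; symE   = λ x y Idxy → subst (λ w → Id w x ≡ true) (Id⇒≡ Idxy) (Id-refl x)
  ; transE = λ x y z Idxy Idyz → subst (λ w → Id x w ≡ true) (Id⇒≡ Idyz) Idxy
  }

≐-sym : {E F : Rel₂ n} → E ≐ F → F ≐ E
≐-sym E≐F x y = sym (E≐F x y)

IsUniqueFactorisation : (Subset n → Subset n) → Rel₂ n → Rel₂ n → Set
IsUniqueFactorisation {n} T E₁ E₂ = ∀ (F₁ F₂ : Rel₂ n) → IsEqRel F₁ → IsEqRel F₂
  → (∀ X → T X ≡ lower F₂ (lower F₁ X)) → (F₁ ≐ E₁) × (F₂ ≐ E₂)

uniqueFactorisation-lower⇒Id : {T : Subset n → Subset n} {E₁ E₂ F : Rel₂ n} → IsEqRel F →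
  (∀ X → T X ≡ lower F X) → IsUniqueFactorisation T E₁ E₂ → (E₁ ≐ Id) × (E₂ ≐ Id)
uniqueFactorisation-lower⇒Id {T = T} {F = F} F-equiv T≡lowerF unique =
  ≐-sym (proj₁ (unique Id F Id-isEqRel F-equiv T≡lowerF∘lowerId)) ,
  ≐-sym (proj₂ (unique F Id F-equiv Id-isEqRel T≡lowerId∘lowerF))
  where
  open IsEqRel F-equiv
  T≡lowerF∘lowerId : ∀ X → T X ≡ lower F (lower Id X)
  T≡lowerF∘lowerId X = trans (T≡lowerF X) (sym (lower-absorbˡ Id-refl transE (Id⊆ᵣ reflE) X))
  T≡lowerId∘lowerF : ∀ X → T X ≡ lower Id (lower F X)
  T≡lowerId∘lowerF X = trans (T≡lowerF X) (sym (lower-absorbʳ Id-refl transE (Id⊆ᵣ reflE) X))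

mainTheorem7 : (n : ℕ) (T : Subset (suc n) → Subset (suc n))
    (E₁ E₂ : Rel₂ (suc n)) → IsEqRel E₁ → IsEqRel E₂
    → (∀ X → T X ≡ lower E₂ (lower E₁ X))
    → (∀ (F₁ F₂ : Rel₂ (suc n)) → IsEqRel F₁ → IsEqRel F₂
         → (∀ X → T X ≡ lower F₂ (lower F₁ X)) → (F₁ ≐ E₁) × (F₂ ≐ E₂))
    → (¬ (E₁ ≐ Id) ⊎ ¬ (E₂ ≐ Id))
    → ¬ (E₁ ⊆ᵣ E₂) × ¬ (E₂ ⊆ᵣ E₁)
mainTheorem7 _ _ E₁ E₂ E₁-equiv E₂-equiv T≡ unique notBothId = E₁⊈E₂ , E₂⊈E₁
  where
  bothId-impossible : ¬ ((E₁ ≐ Id) × (E₂ ≐ Id))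
  bothId-impossible (E₁≐Id , E₂≐Id) = [ (λ E₁≉Id → E₁≉Id E₁≐Id) , (λ E₂≉Id → E₂≉Id E₂≐Id) ] notBothId

  E₁⊈E₂ : ¬ (E₁ ⊆ᵣ E₂)
  E₁⊈E₂ E₁⊆E₂ = bothId-impossible (uniqueFactorisation-lower⇒Id E₂-equiv
    (λ X → trans (T≡ X) (lower-absorbˡ (IsEqRel.reflE E₁-equiv) (IsEqRel.transE E₂-equiv) E₁⊆E₂ X))
    unique)

  E₂⊈E₁ : ¬ (E₂ ⊆ᵣ E₁)
  E₂⊈E₁ E₂⊆E₁ = bothId-impossible (uniqueFactorisation-lower⇒Id E₁-equiv
    (λ X → trans (T≡ X) (lower-absorbʳ (IsEqRel.reflE E₂-equiv) (IsEqRel.transE E₁-equiv) E₂⊆E₁ X))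
    unique)
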